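{- Let $S$ be a finite nonempty set of positive integers and set $s=\max S$. There exists a periodic dominating set $D$ of $G(S)$ with period at most $(2s)2^{2s}$ such that $\delta(D)\le\delta(D')$ for every dominating set $D'$ of $G(S)$; that is, the minimum density of a dominating set in $G(S)$ is achieved by a periodic set with period at most $(2s)2^{2s}$.
   Context: The distance graph $G(S)$ has vertex set $\mathbb{Z}$, with $i,j$ adjacent iff $|i-j|\in S$. A set $D\subseteq\mathbb{Z}$ is dominating if every integer is in $D$ or adjacent to an element of $D$. The density of $A\subseteq\mathbb{Z}$ is $\delta(A)=\limsup_{N\to\infty}\frac{|A\cap[-N,N]|}{2N+1}$. A set $A$ is periodic with period $p\ge1$ if $A+p=A$. -}

module Defs where

open import Level using (0ℓ)
open import Data.Nat as ℕ using (ℕ; suc; _⊔_)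
open import Data.Integer as ℤ using (ℤ; +_; -_; ∣_∣)
open import Data.Rational as ℚ using (ℚ; _/_)
open import Data.Fin using (Fin)
import Data.Fin as Fin
open import Data.List using (List; foldr)
open import Data.List.Membership.Propositional using (_∈_)
open import Data.Product using (Σ; ∃; _×_)
open import Data.Sum using (_⊎_)

Subset : Set₁
Subset = ℤ → Set

-- max S (0 for the empty list; S will be assumed nonempty)
maxList : List ℕ → ℕ
maxList = foldr _⊔_ 0

Adj : List ℕ → ℤ → ℤ → Set
Adj S i j = ∣ i ℤ.- j ∣ ∈ S

Dominating : List ℕ → Subset → Set
Dominating S D = ∀ (x : ℤ) → D x ⊎ (∃ λ d → D d × Adj S x d)

Periodic : Subset → ℕ → Set
Periodic A p = ∀ (x : ℤ) → (A (x ℤ.+ + p) → A x) × (A x → A (x ℤ.+ + p))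

AtLeast : Subset → ℕ → ℕ → Set
AtLeast A N k =
  Σ (Fin k → ℤ) λ f →
    (∀ i j → i Fin.< j → f i ℤ.< f j) ×
    (∀ i → A (f i) × ((- (+ N)) ℤ.≤ f i × f i ℤ.≤ + N))

-- "δ(A) ≥ q", where δ(A) = limsup_N |A ∩ [-N,N]| / (2N+1):
-- for every rational q' < q and every M there is N ≥ M with
-- |A ∩ [-N,N]| / (2N+1) > q'.
DensityAtLeast : Subset → ℚ → Set
DensityAtLeast A q =
  ∀ (q' : ℚ) → q' ℚ.< q → ∀ (M : ℕ) →
    ∃ λ N → M ℕ.≤ N × ∃ λ k → AtLeast A N k × q' ℚ.< (+ k) / suc (2 ℕ.* N)

-- "δ(A) ≤ δ(B)": every rational lower bound of δ(A) is one of δ(B).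
DensityLe : Subset → Subset → Set
DensityLe A B = ∀ (q : ℚ) → DensityAtLeast A q → DensityAtLeast B q

-- Fix a dominating set and look at it through windows of length 2s, s = max S. Among K + 1 windows
-- starting at consecutive points two coincide, since there are only K = 2^(2s) of them. The stretch
-- between two equal windows, repeated periodically, is again dominating, and cutting it out leaves a
-- dominated configuration. Repeating the cut shows that on every long interval the dominating set has
-- at least the density w/p of the best dominating cycle of length p ≤ K; extending that cycle
-- periodically to ℤ attains this density.
module Submission where

open import Defs
open import Data.Bool using (Bool; true; false; if_then_else_; T)
open import Data.Bool.Properties using (T-≡) renaming (_≟_ to _≟ᵇ_)
open import Data.Nat using (ℕ; zero; suc; _+_; _*_; _∸_; _^_; _⊔_; _≤_; _<_; z≤n; s≤s; s≤s⁻¹; z<s; _≟_; _≤?_; _<?_; NonZero)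
open import Data.Nat.Properties
open import Data.Nat.DivMod using (_mod_; _%_; m%n<n; m≡m%n+[m/n]*n; m/n*n≤m; [m+n]%n≡m%n; m<n⇒m%n≡m)
import Data.Nat.DivMod as ℕ using (_/_)
open import Data.Nat.Induction using (<-rec)
open import Data.Nat.Tactic.RingSolver using (solve-∀)
open import Data.Integer as ℤ using (ℤ; +_; -[1+_]; -_; ∣_∣)
import Data.Integer.Properties as ℤ
import Data.Integer.Tactic.RingSolver as ℤ
open import Data.Rational as ℚ using (ℚ; ↥_; ↧_; ↧ₙ_)
import Data.Rational.Properties as ℚ
import Data.Rational.Unnormalised as ℚᵘ
import Data.Rational.Unnormalised.Properties as ℚᵘ
open import Data.Fin as Fin using (Fin; toℕ; fromℕ<; funToFin; finToFun)
open import Data.Fin.Properties using (fromℕ<-cong; toℕ-fromℕ<; toℕ<n; any?; all?; pigeonhole; 2↔Bool; finToFun-funToFin)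
open import Data.Fin.Subset.Properties using (anySubset?)
open import Data.Vec using (Vec; lookup; tabulate) renaming (_∷_ to _∷ᵥ_; [] to []ᵥ)
open import Data.Vec.Properties using (lookup∘tabulate)
open import Data.List using (List; []; _∷_; filter; cartesianProduct; upTo)
open import Data.List.Membership.Propositional using (_∈_; find; lose)
open import Data.List.Membership.Propositional.Properties using (∈-filter⁺; ∈-filter⁻; ∈-cartesianProduct⁺; ∈-upTo⁺)
open import Data.List.Relation.Unary.Any using (Any; here; there) renaming (any? to anyᴸ?)
open import Data.List.Relation.Unary.All as All using (All; _∷_)
open import Relation.Binary.Bundles using (DecTotalOrder)
open import Data.List.Extrema (DecTotalOrder.totalOrder ℚ.≤-decTotalOrder) using (argmin; argmin-all; f[argmin]≤f[xs])
open import Data.Product using (Σ; ∃; ∃₂; _×_; _,_; proj₁; proj₂)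
open import Data.Sum using (_⊎_; inj₁; inj₂)
open import Data.Empty using (⊥-elim)
open import Function using (_∘_; _$_; Equivalence; Inverse)
open import Relation.Nullary using (Dec; yes; no; isYes; contradiction)
open import Relation.Nullary.Decidable using (_⊎-dec_; _×-dec_; map′; dec-true; isYes≗does; toWitness)
open import Relation.Binary.PropositionalEquality

-- Comparing densities through rational rates

private
  pos-*-<⁻ : ∀ a b c d → + a ℤ.* + b ℤ.< + c ℤ.* + d → a * b < c * d
  pos-*-<⁻ a b c d lt = ℤ.drop‿+<+ (subst₂ ℤ._<_ (sym (ℤ.pos-* a b)) (sym (ℤ.pos-* c d)) lt)

  pos-*-<⁺ : ∀ a b c d → a * b < c * d → + a ℤ.* + b ℤ.< + c ℤ.* + d
  pos-*-<⁺ a b c d lt = subst₂ ℤ._<_ (ℤ.pos-* a b) (ℤ.pos-* c d) (ℤ.+<+ lt)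

  pos-*-≤⁻ : ∀ a b c d → + a ℤ.* + b ℤ.≤ + c ℤ.* + d → a * b ≤ c * d
  pos-*-≤⁻ a b c d le = ℤ.drop‿+≤+ (subst₂ ℤ._≤_ (sym (ℤ.pos-* a b)) (sym (ℤ.pos-* c d)) le)

<-/⁻ : ∀ i m {q} → q ℚ.< i ℚ./ suc m → ↥ q ℤ.* + suc m ℤ.< i ℤ.* ↧ q
<-/⁻ i m {q@record{}} q<i/m =
  ℚᵘ.drop-*<* (ℚᵘ.<-respʳ-≃ (ℚ.toℚᵘ-fromℚᵘ (ℚᵘ.mkℚᵘ i m)) (ℚ.toℚᵘ-mono-< q<i/m))

<-/⁺ : ∀ i m {q} → ↥ q ℤ.* + suc m ℤ.< i ℤ.* ↧ q → q ℚ.< i ℚ./ suc m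
<-/⁺ i m {q@record{}} lt =
  ℚ.toℚᵘ-cancel-< (ℚᵘ.<-respʳ-≃ (ℚᵘ.≃-sym (ℚ.toℚᵘ-fromℚᵘ (ℚᵘ.mkℚᵘ i m))) (ℚᵘ.*<* lt))

/-<⁻ : ∀ i m {q} → i ℚ./ suc m ℚ.< q → i ℤ.* ↧ q ℤ.< ↥ q ℤ.* + suc m
/-<⁻ i m {q@record{}} i/m<q =
  ℚᵘ.drop-*<* (ℚᵘ.<-respˡ-≃ (ℚ.toℚᵘ-fromℚᵘ (ℚᵘ.mkℚᵘ i m)) (ℚ.toℚᵘ-mono-< i/m<q))

/-≤-/⁻ : ∀ w l w′ l′ → + w ℚ./ suc l ℚ.≤ + w′ ℚ./ suc l′ → w * suc l′ ≤ w′ * suc l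
/-≤-/⁻ w l w′ l′ le = pos-*-≤⁻ w (suc l′) w′ (suc l) $ ℚᵘ.drop-*≤* $
  ℚᵘ.≤-respʳ-≃ (ℚ.toℚᵘ-fromℚᵘ (ℚᵘ.mkℚᵘ (+ w′) l′)) $
  ℚᵘ.≤-respˡ-≃ (ℚ.toℚᵘ-fromℚᵘ (ℚᵘ.mkℚᵘ (+ w) l)) (ℚ.toℚᵘ-mono-≤ le)

UpperRate : Subset → ℕ → ℕ → ℕ → Set
UpperRate A P W E = ∀ N k → AtLeast A N k → P * k ≤ W * suc (2 * N) + E

LowerRate : Subset → ℕ → ℕ → ℕ → Set
LowerRate A P W E = ∀ N → ∃ λ k → AtLeast A N k × W * suc (2 * N) ≤ P * k + E

-- Cross-multiplied: with an upper rate W/P, W/P < m/b < k/n forces n ≤ E b; with a lower rate,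
-- m/b < W/P forces m/b < k/n once n > E b.
upperRate-cross : ∀ W P m b n k E → W * b < m * P → m * n < k * b → P * k ≤ W * n + E → n ≤ E * b
upperRate-cross W P m b n k E Wb<mP mn<kb Pk≤ = +-cancelˡ-≤ (W * b * n) n (E * b) $ begin
  W * b * n + n     ≡⟨ +-comm (W * b * n) n ⟩
  suc (W * b) * n   ≤⟨ *-monoˡ-≤ n Wb<mP ⟩
  m * P * n         ≡⟨ reassoc m P n ⟩
  P * (m * n)       ≤⟨ *-monoʳ-≤ P (<⇒≤ mn<kb) ⟩
  P * (k * b)       ≡⟨ *-assoc P k b ⟨
  P * k * b         ≤⟨ *-monoˡ-≤ b Pk≤ ⟩
  (W * n + E) * b   ≡⟨ distrib W n E b ⟩
  W * b * n + E * b ∎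
  where
  open ≤-Reasoning
  reassoc : ∀ m P n → m * P * n ≡ P * (m * n)
  reassoc = solve-∀
  distrib : ∀ W n E b → (W * n + E) * b ≡ W * b * n + E * b
  distrib = solve-∀

lowerRate-cross : ∀ W P m b n k E → m * P < W * b → W * n ≤ P * k + E → E * b < n → m * n < k * b
lowerRate-cross W P m b n k E mP<Wb Wn≤ Eb<n =
  *-cancelˡ-< P (m * n) (k * b) $ +-cancelʳ-< n (P * (m * n)) (P * (k * b)) $ begin-strict
    P * (m * n) + n     ≡⟨ reassoc P m n ⟩
    suc (m * P) * n     ≤⟨ *-monoˡ-≤ n mP<Wb ⟩
    W * b * n           ≡⟨ reassoc′ W b n ⟩
    b * (W * n)         ≤⟨ *-monoʳ-≤ b Wn≤ ⟩
    b * (P * k + E)     ≡⟨ distrib b P k E ⟩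
    P * (k * b) + E * b <⟨ +-monoʳ-< (P * (k * b)) Eb<n ⟩
    P * (k * b) + n     ∎
  where
  open ≤-Reasoning
  reassoc : ∀ P m n → P * (m * n) + n ≡ suc (m * P) * n
  reassoc = solve-∀
  reassoc′ : ∀ W b n → W * b * n ≡ b * (W * n)
  reassoc′ = solve-∀
  distrib : ∀ b P k E → b * (P * k + E) ≡ P * (k * b) + E * b
  distrib = solve-∀

upperRate⇒density≤ : ∀ {A p W E q} → UpperRate A (suc p) W E → DensityAtLeast A q → q ℚ.≤ + W ℚ./ suc p
upperRate⇒density≤ {A} {p} {W} {E} {q} upper dens = ℚ.≮⇒≥ λ rate<q →
  let q′ , rate<q′ , q′<q = ℚ.<-dense rate<q
      N , Eb≤N , k , atLeast , q′<k/n = dens q′ q′<q (E * ↧ₙ q′)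
      n≤Eb = window≤ (↥ q′) (/-<⁻ (+ W) p rate<q′) (<-/⁻ (+ k) (2 * N) q′<k/n) (upper N k atLeast)
  in <⇒≱ (s≤s (≤-trans Eb≤N (m≤m+n N _))) n≤Eb
  where
  window≤ : ∀ i {b n k} → + W ℤ.* + b ℤ.< i ℤ.* + suc p → i ℤ.* + n ℤ.< + k ℤ.* + b →
            suc p * k ≤ W * n + E → n ≤ E * b
  window≤ (+ m) {b} {n} {k} Wb<mP mn<kb Pk≤ =
    upperRate-cross W (suc p) m b n k E (pos-*-<⁻ W b m (suc p) Wb<mP) (pos-*-<⁻ m n k b mn<kb) Pk≤
  window≤ -[1+ _ ] {b} Wb<iP _ _ = ⊥-elim (ℤ.+≮- (subst (ℤ._< _) (sym (ℤ.pos-* W b)) Wb<iP))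

lowerRate⇒densityAtLeast : ∀ {A p W E} → LowerRate A (suc p) W E → DensityAtLeast A (+ W ℚ./ suc p)
lowerRate⇒densityAtLeast {A} {p} {W} {E} lower q q<rate M =
  N , m≤m+n M _ , k , atLeast , <-/⁺ (+ k) (2 * N) (density< (↥ q) (<-/⁻ (+ W) p q<rate))
  where
  N : ℕ
  N = M + E * ↧ₙ q
  k : ℕ
  k = proj₁ (lower N)
  atLeast : AtLeast A N k
  atLeast = proj₁ (proj₂ (lower N))
  Eb<n : E * ↧ₙ q < suc (2 * N)
  Eb<n = s≤s (≤-trans (m≤n+m _ M) (m≤m+n N _))
  density< : ∀ i → i ℤ.* + suc p ℤ.< + W ℤ.* ↧ q → i ℤ.* + suc (2 * N) ℤ.< + k ℤ.* ↧ q
  density< (+ m) mP<Wb = pos-*-<⁺ m _ k _ $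
    lowerRate-cross W (suc p) m (↧ₙ q) (suc (2 * N)) k E
      (pos-*-<⁻ m (suc p) W (↧ₙ q) mP<Wb) (proj₂ (proj₂ (lower N))) Eb<n
  density< -[1+ _ ] _ = subst (_ ℤ.<_) (ℤ.pos-* k (↧ₙ q)) ℤ.-<+

rates⇒densityLe : ∀ {D D′ p W E E′} → UpperRate D (suc p) W E → LowerRate D′ (suc p) W E′ → DensityLe D D′
rates⇒densityLe {D} {D′} {p} {W} {E} {E′} upper lower q dens q′ q′<q =
  lowerRate⇒densityAtLeast {D′} {p} {W} {E′} lower q′
    (ℚ.<-≤-trans q′<q (upperRate⇒density≤ {D} {p} {W} {E} upper dens))

-- Counting along ℕ

indicator : Bool → ℕ
indicator b = if b then 1 else 0

count : (ℕ → Bool) → ℕ → ℕ → ℕ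
count c a zero = 0
count c a (suc n) = indicator (c a) + count c (suc a) n

count-cong : ∀ b c a a′ n → (∀ t → t < n → b (a + t) ≡ c (a′ + t)) → count b a n ≡ count c a′ n
count-cong b c a a′ zero _ = refl
count-cong b c a a′ (suc n) b≗c =
  cong₂ (λ x r → indicator x + r) head (count-cong b c (suc a) (suc a′) n tail)
  where
  head : b a ≡ c a′
  head = subst₂ (λ u v → b u ≡ c v) (+-identityʳ a) (+-identityʳ a′) (b≗c 0 z<s)
  tail : ∀ t → t < n → b (suc a + t) ≡ c (suc a′ + t)
  tail t t<n = subst₂ (λ u v → b u ≡ c v) (+-suc a t) (+-suc a′ t) (b≗c (suc t) (s≤s t<n))

count-+ : ∀ c a m n → count c a (m + n) ≡ count c a m + count c (a + m) n
count-+ c a zero n = cong (λ a → count c a n) (sym (+-identityʳ a))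
count-+ c a (suc m) n = begin
  i + count c (suc a) (m + n)                     ≡⟨ cong (λ r → i + r) (count-+ c (suc a) m n) ⟩
  i + (count c (suc a) m + count c (suc a + m) n) ≡⟨ +-assoc i (count c (suc a) m) _ ⟨
  count c a (suc m) + count c (suc a + m) n       ≡⟨ cong (λ a′ → count c a (suc m) + count c a′ n) (+-suc a m) ⟨
  count c a (suc m) + count c (a + suc m) n       ∎
  where
  open ≡-Reasoning
  i : ℕ
  i = indicator (c a)

count≤ : ∀ c a n → count c a n ≤ n
count≤ c a zero = z≤n
count≤ c a (suc n) with c a
... | true = s≤s (count≤ c (suc a) n)
... | false = m≤n⇒m≤1+n (count≤ c (suc a) n)

count-mono : ∀ c a {m n} → m ≤ n → count c a m ≤ count c a n
count-mono c a {m} {n} m≤n = begin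
  count c a m                           ≤⟨ m≤m+n _ _ ⟩
  count c a m + count c (a + m) (n ∸ m) ≡⟨ count-+ c a m (n ∸ m) ⟨
  count c a (m + (n ∸ m))               ≡⟨ cong (count c a) (m+[n∸m]≡n m≤n) ⟩
  count c a n                           ∎
  where open ≤-Reasoning

count-suc≤ : ∀ c a n → count c (suc a) n ≤ count c a (suc n)
count-suc≤ c a n with c a
... | true = n≤1+n _
... | false = ≤-refl

Points : (ℕ → Bool) → ℕ → ℕ → ℕ → Set
Points c a n k =
  Σ (Fin k → ℕ) λ f → (∀ i j → i Fin.< j → f i < f j) × (∀ i → (a ≤ f i × f i < a + n) × c (f i) ≡ true)

points-narrow : ∀ c {a n k} ((f , _) : Points c a (suc n) k) → (∀ i → a < f i) → Points c (suc a) n k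
points-narrow c {a} {n} (f , inc , pts) a<f =
  f , inc , λ i → (a<f i , subst (f i <_) (+-suc a n) (proj₂ (proj₁ (pts i)))) , proj₂ (pts i)

points-widen : ∀ c {a n k} → Points c (suc a) n k → Points c a (suc n) k
points-widen c {a} {n} (f , inc , pts) =
  f , inc , λ i → (<⇒≤ (proj₁ (proj₁ (pts i))) , subst (f i <_) (sym (+-suc a n)) (proj₂ (proj₁ (pts i)))) ,
                  proj₂ (pts i)

points⇒≤count : ∀ c a n k → Points c a n k → k ≤ count c a n
points⇒≤count c a n zero _ = z≤n
points⇒≤count c a zero (suc k) (f , _ , pts) =
  contradiction f₀<a+0 (≤⇒≯ (≤-trans (≤-reflexive (+-identityʳ a)) a≤f₀))
  where
  a≤f₀ : a ≤ f Fin.zero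
  a≤f₀ = proj₁ (proj₁ (pts Fin.zero))
  f₀<a+0 : f Fin.zero < a + 0
  f₀<a+0 = proj₂ (proj₁ (pts Fin.zero))
points⇒≤count c a (suc n) (suc k) p@(f , inc , pts) with f Fin.zero ≟ a
... | yes refl = subst (λ x → suc k ≤ indicator x + count c (suc a) n) (sym (proj₂ (pts Fin.zero)))
                   (s≤s (points⇒≤count c (suc a) n k (points-narrow c rest (λ i → inc Fin.zero (Fin.suc i) z<s))))
  where
  rest : Points c a (suc n) k
  rest = f ∘ Fin.suc , (λ i j → inc (Fin.suc i) (Fin.suc j) ∘ s≤s) , pts ∘ Fin.suc
... | no f₀≢a = ≤-trans (points⇒≤count c (suc a) n (suc k) (points-narrow c p a<f)) (count-suc≤ c a n)
  where
  a<f₀ : a < f Fin.zero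
  a<f₀ = ≤∧≢⇒< (proj₁ (proj₁ (pts Fin.zero))) (f₀≢a ∘ sym)
  a<f : ∀ i → a < f i
  a<f Fin.zero = a<f₀
  a<f (Fin.suc i) = <-trans a<f₀ (inc Fin.zero (Fin.suc i) z<s)

count-points : ∀ c a n → Points c a n (count c a n)
count-points c a zero = (λ ()) , (λ ()) , (λ ())
count-points c a (suc n) with c a in ca | count-points c (suc a) n
... | false | rest = points-widen c rest
... | true | rest@(f , inc , pts) = f′ , inc′ , pts′
  where
  f′ : Fin (suc (count c (suc a) n)) → ℕ
  f′ Fin.zero = a
  f′ (Fin.suc i) = f i
  inc′ : ∀ i j → i Fin.< j → f′ i < f′ j
  inc′ Fin.zero (Fin.suc j) _ = proj₁ (proj₁ (pts j))
  inc′ (Fin.suc i) (Fin.suc j) i<j = inc i j (s≤s⁻¹ i<j)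
  pts′ : ∀ i → (a ≤ f′ i × f′ i < a + suc n) × c (f′ i) ≡ true
  pts′ Fin.zero = (≤-refl , m<m+n a z<s) , ca
  pts′ (Fin.suc i) = proj₂ (proj₂ (points-widen c rest)) i

PeriodicSeq : (ℕ → Bool) → ℕ → Set
PeriodicSeq c P = ∀ t → c (t + P) ≡ c t

periodic-* : ∀ {c P} → PeriodicSeq c P → ∀ t q → c (t + q * P) ≡ c t
periodic-* {c} per t zero = cong c (+-identityʳ t)
periodic-* {c} {P} per t (suc q) = begin
  c (t + (P + q * P)) ≡⟨ cong c (+-assoc t P (q * P)) ⟨
  c (t + P + q * P)   ≡⟨ periodic-* per (t + P) q ⟩
  c (t + P)           ≡⟨ per t ⟩
  c t                 ∎
  where open ≡-Reasoning

module _ {c P} (per : PeriodicSeq c P) where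

  count-period-suc : ∀ a → count c (suc a) P ≡ count c a P
  count-period-suc a = +-cancelˡ-≡ (indicator (c a)) _ _ $ begin
    count c a (suc P)                         ≡⟨ cong (count c a) (+-comm 1 P) ⟩
    count c a (P + 1)                         ≡⟨ count-+ c a P 1 ⟩
    count c a P + (indicator (c (a + P)) + 0) ≡⟨ cong (λ b → count c a P + (indicator b + 0)) (per a) ⟩
    count c a P + (indicator (c a) + 0)       ≡⟨ cong (λ r → count c a P + r) (+-identityʳ _) ⟩
    count c a P + indicator (c a)             ≡⟨ +-comm (count c a P) _ ⟩
    indicator (c a) + count c a P             ∎
    where open ≡-Reasoning

  count-period : ∀ a → count c a P ≡ count c 0 P
  count-period zero = refl
  count-period (suc a) = trans (count-period-suc a) (count-period a)

  count-periods : ∀ a q → count c a (q * P) ≡ q * count c 0 P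
  count-periods a zero = refl
  count-periods a (suc q) = begin
    count c a (P + q * P)                 ≡⟨ count-+ c a P (q * P) ⟩
    count c a P + count c (a + P) (q * P) ≡⟨ cong₂ _+_ (count-period a) (count-periods (a + P) q) ⟩
    count c 0 P + q * count c 0 P         ∎
    where open ≡-Reasoning

  count-periodic-≤ : .{{_ : NonZero P}} → ∀ a n → P * count c a n ≤ count c 0 P * n + P * count c 0 P
  count-periodic-≤ a n = begin
    P * count c a n           ≤⟨ *-monoʳ-≤ P (count-mono c a (<⇒≤ n<[1+q]P)) ⟩
    P * count c a (suc q * P) ≡⟨ cong (P *_) (count-periods a (suc q)) ⟩
    P * (suc q * W)           ≡⟨ rearrange P q W ⟩
    W * (q * P) + P * W       ≤⟨ +-monoˡ-≤ (P * W) (*-monoʳ-≤ W (m/n*n≤m n P)) ⟩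
    W * n + P * W             ∎
    where
    open ≤-Reasoning
    W q : ℕ
    W = count c 0 P
    q = n ℕ./ P
    n<[1+q]P : n < suc q * P
    n<[1+q]P = begin-strict
      n             ≡⟨ m≡m%n+[m/n]*n n P ⟩
      n % P + q * P <⟨ +-monoˡ-< (q * P) (m%n<n n P) ⟩
      P + q * P     ∎
    rearrange : ∀ P q W → P * (suc q * W) ≡ W * (q * P) + P * W
    rearrange = solve-∀

-- Windows of ℤ and periodic extensions

private
  +t-N≡z : ∀ {t N z} → + t ≡ z ℤ.+ + N → + t ℤ.- + N ≡ z
  +t-N≡z {t} {N} {z} eq = trans (cong (ℤ._- + N) eq) (cancel z (+ N))
    where
    cancel : ∀ z n → z ℤ.+ n ℤ.- n ≡ z
    cancel = ℤ.solve-∀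

  +-N-mono-< : ∀ N {t u} → t < u → + t ℤ.- + N ℤ.< + u ℤ.- + N
  +-N-mono-< N t<u = ℤ.+-monoˡ-< (- (+ N)) (ℤ.+<+ t<u)

  toWindow : ∀ N z → - (+ N) ℤ.≤ z → Σ ℕ λ t → + t ≡ z ℤ.+ + N
  toWindow N z -N≤z =
    ∣ z ℤ.+ + N ∣ , ℤ.0≤i⇒+∣i∣≡i (subst (ℤ._≤ z ℤ.+ + N) (ℤ.+-inverseˡ (+ N)) (ℤ.+-monoˡ-≤ (+ N) -N≤z))

atLeast⇒≤count : ∀ {A N k} c → (∀ t → A (+ t ℤ.- + N) → c t ≡ true) → AtLeast A N k →
                 k ≤ count c 0 (suc (2 * N))
atLeast⇒≤count {A} {N} {k} c A⇒c (f , inc , pts) = points⇒≤count c 0 (suc (2 * N)) k (g , inc′ , pts′)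
  where
  g : Fin k → ℕ
  g i = proj₁ (toWindow N (f i) (proj₁ (proj₂ (pts i))))
  g≡ : ∀ i → + g i ≡ f i ℤ.+ + N
  g≡ i = proj₂ (toWindow N (f i) (proj₁ (proj₂ (pts i))))
  inc′ : ∀ i j → i Fin.< j → g i < g j
  inc′ i j i<j = ℤ.drop‿+<+ (subst₂ ℤ._<_ (sym (g≡ i)) (sym (g≡ j)) (ℤ.+-monoˡ-< (+ N) (inc i j i<j)))
  g≤2N : ∀ i → g i ≤ 2 * N
  g≤2N i = ℤ.drop‿+≤+ (subst₂ ℤ._≤_ (sym (g≡ i)) N+N≡2N (ℤ.+-monoˡ-≤ (+ N) (proj₂ (proj₂ (pts i)))))
    where
    N+N≡2N : + N ℤ.+ + N ≡ + (2 * N)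
    N+N≡2N = cong (λ n → + (N + n)) (sym (+-identityʳ N))
  pts′ : ∀ i → (0 ≤ g i × g i < suc (2 * N)) × c (g i) ≡ true
  pts′ i = (z≤n , s≤s (g≤2N i)) , A⇒c (g i) (subst A (sym (+t-N≡z (g≡ i))) (proj₁ (pts i)))

count⇒atLeast : ∀ {A} N c → (∀ t → c t ≡ true → A (+ t ℤ.- + N)) → AtLeast A N (count c 0 (suc (2 * N)))
count⇒atLeast {A} N c c⇒A = (λ i → + g i ℤ.- + N) , (λ i j i<j → +-N-mono-< N (inc i j i<j)) , pts′
  where
  points : Points c 0 (suc (2 * N)) (count c 0 (suc (2 * N)))
  points = count-points c 0 (suc (2 * N))
  g : Fin (count c 0 (suc (2 * N))) → ℕ
  g = proj₁ points
  inc : ∀ i j → i Fin.< j → g i < g j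
  inc = proj₁ (proj₂ points)
  pts′ : ∀ i → A (+ g i ℤ.- + N) × (- (+ N) ℤ.≤ + g i ℤ.- + N × + g i ℤ.- + N ℤ.≤ + N)
  pts′ i = c⇒A (g i) (proj₂ (proj₂ (proj₂ points) i)) , lower , upper
    where
    lower : - (+ N) ℤ.≤ + g i ℤ.- + N
    lower = subst (ℤ._≤ + g i ℤ.- + N) (ℤ.+-identityˡ (- (+ N))) (ℤ.+-monoˡ-≤ (- (+ N)) (ℤ.+≤+ z≤n))
    g≤2N : g i ≤ N + N
    g≤2N = subst (g i ≤_) (cong (λ n → N + n) (+-identityʳ N)) (s≤s⁻¹ (proj₂ (proj₁ (proj₂ (proj₂ points) i))))
    upper : + g i ℤ.- + N ℤ.≤ + N
    upper = subst (+ g i ℤ.- + N ℤ.≤_) (+t-N≡z (ℤ.pos-+ N N)) (ℤ.+-monoˡ-≤ (- (+ N)) (ℤ.+≤+ g≤2N))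

PeriodicExtension : (ℕ → Bool) → ℕ → Subset
PeriodicExtension c P z = ∃₂ λ m x → z ℤ.+ + (m * P) ≡ + x × c x ≡ true

periodicExtension-periodic : ∀ {c P} → PeriodicSeq c P → Periodic (PeriodicExtension c P) P
periodicExtension-periodic {c} {P} per z = backward , forward
  where
  backward : PeriodicExtension c P (z ℤ.+ + P) → PeriodicExtension c P z
  backward (m , x , z+P+mP≡x , cx) =
    suc m , x , trans (trans (cong (λ k → z ℤ.+ k) (ℤ.pos-+ P (m * P))) (sym (ℤ.+-assoc z (+ P) _))) z+P+mP≡x , cx
  forward : PeriodicExtension c P z → PeriodicExtension c P (z ℤ.+ + P)
  forward (m , x , z+mP≡x , cx) =
    m , x + P , trans (swap z (+ P) _) (trans (cong (ℤ._+ + P) z+mP≡x) (sym (ℤ.pos-+ x P))) , trans (per x) cx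
    where
    swap : ∀ a b c → a ℤ.+ b ℤ.+ c ≡ a ℤ.+ c ℤ.+ b
    swap = ℤ.solve-∀

periodicExtension-sound : ∀ {c P z y} n → PeriodicSeq c P → PeriodicExtension c P z →
                          z ℤ.+ + (n * P) ≡ + y → c y ≡ true
periodicExtension-sound {c} {P} {z} {y} n per (m , x , z+mP≡x , cx) z+nP≡y = begin
  c y           ≡⟨ periodic-* per y m ⟨
  c (y + m * P) ≡⟨ cong c (ℤ.+-injective same) ⟨
  c (x + n * P) ≡⟨ periodic-* per x n ⟩
  c x           ≡⟨ cx ⟩
  true          ∎
  where
  open ≡-Reasoning
  swap : ∀ a b c → a ℤ.+ b ℤ.+ c ≡ a ℤ.+ c ℤ.+ b
  swap = ℤ.solve-∀
  same : + (x + n * P) ≡ + (y + m * P)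
  same = begin
    + (x + n * P)                      ≡⟨ ℤ.pos-+ x (n * P) ⟩
    + x ℤ.+ + (n * P)                  ≡⟨ cong (ℤ._+ + (n * P)) z+mP≡x ⟨
    z ℤ.+ + (m * P) ℤ.+ + (n * P)      ≡⟨ swap z _ _ ⟩
    z ℤ.+ + (n * P) ℤ.+ + (m * P)      ≡⟨ cong (ℤ._+ + (m * P)) z+nP≡y ⟩
    + y ℤ.+ + (m * P)                  ≡⟨ ℤ.pos-+ y (m * P) ⟨
    + (y + m * P)                      ∎

natural-representative : ∀ l a z → ∃₂ λ m x → z ℤ.+ + (m * suc l) ≡ + x × a ≤ x
natural-representative l a (+ n) =
  a , n + a * suc l , sym (ℤ.pos-+ n (a * suc l)) , ≤-trans (m≤m*n a (suc l)) (m≤n+m _ n)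
natural-representative l a -[1+ n ] = suc n + a , a + (suc n + a) * l , eq , m≤m+n a _
  where
  cancel : ∀ x y → - x ℤ.+ (x ℤ.+ y) ≡ y
  cancel = ℤ.solve-∀
  eq : -[1+ n ] ℤ.+ + ((suc n + a) * suc l) ≡ + (a + (suc n + a) * l)
  eq = begin
    -[1+ n ] ℤ.+ + ((suc n + a) * suc l)            ≡⟨ cong (λ k → -[1+ n ] ℤ.+ + k) (*-suc (suc n + a) l) ⟩
    -[1+ n ] ℤ.+ + (suc n + a + (suc n + a) * l)    ≡⟨ cong (λ k → -[1+ n ] ℤ.+ + k) (+-assoc (suc n) a _) ⟩
    -[1+ n ] ℤ.+ + (suc n + (a + (suc n + a) * l))  ≡⟨ cong (λ k → -[1+ n ] ℤ.+ k) (ℤ.pos-+ (suc n) _) ⟩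
    - + suc n ℤ.+ (+ suc n ℤ.+ + (a + (suc n + a) * l)) ≡⟨ cancel (+ suc n) _ ⟩
    + (a + (suc n + a) * l)                         ∎
    where open ≡-Reasoning

periodicExtension-upperRate : ∀ {c l} → PeriodicSeq c (suc l) →
                      UpperRate (PeriodicExtension c (suc l)) (suc l) (count c 0 (suc l)) (suc l * count c 0 (suc l))
periodicExtension-upperRate {c} {l} per N k atLeast =
  ≤-trans (*-monoʳ-≤ (suc l) k≤count) (count-periodic-≤ per (N * l) (suc (2 * N)))
  where
  shift : ∀ t → + t ℤ.- + N ℤ.+ + (N * suc l) ≡ + (N * l + t)
  shift t = begin
    + t ℤ.- + N ℤ.+ + (N * suc l)         ≡⟨ cong (λ k → + t ℤ.- + N ℤ.+ + k) (*-suc N l) ⟩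
    + t ℤ.- + N ℤ.+ + (N + N * l)         ≡⟨ cong (λ k → + t ℤ.- + N ℤ.+ k) (ℤ.pos-+ N (N * l)) ⟩
    + t ℤ.- + N ℤ.+ (+ N ℤ.+ + (N * l))   ≡⟨ cancel (+ t) (+ N) (+ (N * l)) ⟩
    + (N * l) ℤ.+ + t                     ≡⟨ ℤ.pos-+ (N * l) t ⟨
    + (N * l + t)                         ∎
    where
    open ≡-Reasoning
    cancel : ∀ t n x → t ℤ.- n ℤ.+ (n ℤ.+ x) ≡ x ℤ.+ t
    cancel = ℤ.solve-∀
  k≤count : k ≤ count c (N * l) (suc (2 * N))
  k≤count = subst (k ≤_) (count-cong _ c 0 (N * l) (suc (2 * N)) λ _ _ → refl)
              (atLeast⇒≤count {PeriodicExtension c (suc l)} (λ t → c (N * l + t))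
                 (λ t ext → periodicExtension-sound {z = + t ℤ.- + N} N per ext (shift t)) atLeast)

-- Domination in G(S)

∈⇒≤maxList : ∀ {d} xs → d ∈ xs → d ≤ maxList xs
∈⇒≤maxList (x ∷ xs) (here refl) = m≤m⊔n x (maxList xs)
∈⇒≤maxList (x ∷ xs) (there d∈xs) = ≤-trans (∈⇒≤maxList xs d∈xs) (m≤n⊔m x (maxList xs))

module Domination (S : List ℕ) where

  s : ℕ
  s = maxList S

  ∈⇒≤s : ∀ {d} → d ∈ S → d ≤ s
  ∈⇒≤s = ∈⇒≤maxList S

  -- G(S) restricted to ℕ; the truncated x ∸ d is only ever used with d ≤ s ≤ x
  Dominated : (ℕ → Bool) → ℕ → Set
  Dominated c x = c x ≡ true ⊎ ∃ λ d → d ∈ S × (c (x + d) ≡ true ⊎ c (x ∸ d) ≡ true)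

  dominated? : ∀ c x → Dec (Dominated c x)
  dominated? c x = (c x ≟ᵇ true) ⊎-dec map′ find (λ (_ , d∈S , cd) → lose d∈S cd) neighbour?
    where
    neighbour? : Dec (Any (λ d → c (x + d) ≡ true ⊎ c (x ∸ d) ≡ true) S)
    neighbour? = anyᴸ? (λ d → (c (x + d) ≟ᵇ true) ⊎-dec (c (x ∸ d) ≟ᵇ true)) S

  -- the points whose neighbourhoods lie inside [0, n + 2s)
  InteriorDominated : (ℕ → Bool) → ℕ → Set
  InteriorDominated c n = ∀ x → s ≤ x → x < n + s → Dominated c x

  dominated-shift : ∀ b c a x → s ≤ x → (∀ y → x ≤ y + s → y ≤ x + s → b (a + y) ≡ true → c y ≡ true) →
                    Dominated b (a + x) → Dominated c x
  dominated-shift b c a x s≤x b⇒c (inj₁ bx) = inj₁ (b⇒c x (m≤m+n x s) (m≤m+n x s) bx)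
  dominated-shift b c a x s≤x b⇒c (inj₂ (d , d∈S , inj₁ bx+d)) = inj₂ (d , d∈S , inj₁ (b⇒c (x + d)
    (≤-trans (m≤m+n x d) (m≤m+n (x + d) s)) (+-monoʳ-≤ x (∈⇒≤s d∈S))
    (subst (λ z → b z ≡ true) (+-assoc a x d) bx+d)))
  dominated-shift b c a x s≤x b⇒c (inj₂ (d , d∈S , inj₂ bx-d)) = inj₂ (d , d∈S , inj₂ (b⇒c (x ∸ d)
    x≤x-d+s (≤-trans (m∸n≤m x d) (m≤m+n x s))
    (subst (λ z → b z ≡ true) (+-∸-assoc a d≤x) bx-d)))
    where
    d≤x : d ≤ x
    d≤x = ≤-trans (∈⇒≤s d∈S) s≤x
    x≤x-d+s : x ≤ x ∸ d + s
    x≤x-d+s = subst (_≤ x ∸ d + s) (m∸n+n≡m d≤x) (+-monoʳ-≤ (x ∸ d) (∈⇒≤s d∈S))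

  dominated-periodic : ∀ {c P} → PeriodicSeq c P → ∀ x q → s ≤ x → Dominated c x → Dominated c (x + q * P)
  dominated-periodic per x q s≤x (inj₁ cx) = inj₁ (trans (periodic-* per x q) cx)
  dominated-periodic {c} {P} per x q s≤x (inj₂ (d , d∈S , inj₁ cx+d)) = inj₂ (d , d∈S , inj₁ (begin
    c (x + q * P + d) ≡⟨ cong c (+-assoc x (q * P) d) ⟩
    c (x + (q * P + d)) ≡⟨ cong (λ t → c (x + t)) (+-comm (q * P) d) ⟩
    c (x + (d + q * P)) ≡⟨ cong c (+-assoc x d (q * P)) ⟨
    c (x + d + q * P) ≡⟨ periodic-* per (x + d) q ⟩
    c (x + d) ≡⟨ cx+d ⟩
    true ∎))
    where open ≡-Reasoning
  dominated-periodic {c} {P} per x q s≤x (inj₂ (d , d∈S , inj₂ cx-d)) = inj₂ (d , d∈S , inj₂ (begin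
    c (x + q * P ∸ d) ≡⟨ cong c (+-∸-comm (q * P) (≤-trans (∈⇒≤s d∈S) s≤x)) ⟩
    c (x ∸ d + q * P) ≡⟨ periodic-* per (x ∸ d) q ⟩
    c (x ∸ d) ≡⟨ cx-d ⟩
    true ∎))
    where open ≡-Reasoning

  cycle : ∀ {l} → Vec Bool (suc l) → ℕ → Bool
  cycle {l} v t = lookup v (t mod suc l)

  cycle-periodic : ∀ {l} (v : Vec Bool (suc l)) → PeriodicSeq (cycle v) (suc l)
  cycle-periodic {l} v t = cong (lookup v) (fromℕ<-cong _ _ ([m+n]%n≡m%n t (suc l)) _ _)

  cycle-< : ∀ {l} (v : Vec Bool (suc l)) {t} (t<P : t < suc l) → cycle v t ≡ lookup v (fromℕ< t<P)
  cycle-< {l} v {t} t<P = cong (lookup v) (fromℕ<-cong _ _ (m<n⇒m%n≡m t<P) _ _)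

  DominatingCycle : ∀ {l} → Vec Bool (suc l) → Set
  DominatingCycle {l} v = ∀ (r : Fin (suc l)) → Dominated (cycle v) (s + toℕ r)

  dominatingCycle⇒dominated : ∀ {l} {v : Vec Bool (suc l)} → DominatingCycle v → ∀ x → s ≤ x → Dominated (cycle v) x
  dominatingCycle⇒dominated {l} {v} dom x s≤x =
    subst (Dominated (cycle v)) x≡s+r+qP (dominated-periodic (cycle-periodic v) (s + r) q (m≤m+n s r) dom-r)
    where
    r q : ℕ
    r = (x ∸ s) % suc l
    q = (x ∸ s) ℕ./ suc l
    dom-r : Dominated (cycle v) (s + r)
    dom-r = subst (λ t → Dominated (cycle v) (s + t)) (toℕ-fromℕ< (m%n<n (x ∸ s) (suc l))) (dom ((x ∸ s) mod suc l))
    x≡s+r+qP : s + r + q * suc l ≡ x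
    x≡s+r+qP = begin
      s + r + q * suc l   ≡⟨ +-assoc s r _ ⟩
      s + (r + q * suc l) ≡⟨ cong (λ t → s + t) (m≡m%n+[m/n]*n (x ∸ s) (suc l)) ⟨
      s + (x ∸ s)         ≡⟨ m+[n∸m]≡n s≤x ⟩
      x                   ∎
      where open ≡-Reasoning

  Achievable : ℕ → ℕ → Set
  Achievable w l = ∃ λ (v : Vec Bool (suc l)) → DominatingCycle v × count (cycle v) 0 (suc l) ≡ w

  achievable? : ∀ w l → Dec (Achievable w l)
  achievable? w l =
    anySubset? λ v → all? (λ r → dominated? (cycle v) (s + toℕ r)) ×-dec (count (cycle v) 0 (suc l) ≟ w)

  K : ℕ
  K = 2 ^ (2 * s)

  RepeatsAt : (ℕ → Bool) → ℕ → ℕ → Set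
  RepeatsAt c I L = ∀ u → u < 2 * s → c (I + u) ≡ c (I + L + u)

  window : (ℕ → Bool) → ℕ → Fin K
  window c a = funToFin λ (u : Fin (2 * s)) → Inverse.from 2↔Bool (c (a + toℕ u))

  window-injective : ∀ c a b → window c a ≡ window c b → ∀ u → u < 2 * s → c (a + u) ≡ c (b + u)
  window-injective c a b same u u<2s = begin
    c (a + u)                     ≡⟨ decode a ⟨
    to (finToFun (window c a) u′) ≡⟨ cong (λ w → to (finToFun w u′)) same ⟩
    to (finToFun (window c b) u′) ≡⟨ decode b ⟩
    c (b + u)                     ∎
    where
    open ≡-Reasoning
    open Inverse 2↔Bool using (to; from; strictlyInverseˡ)
    u′ : Fin (2 * s)
    u′ = fromℕ< u<2s
    decode : ∀ a → to (finToFun (window c a) u′) ≡ c (a + u)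
    decode a = begin
      to (finToFun (window c a) u′)     ≡⟨ cong to (finToFun-funToFin _ u′) ⟩
      to (from (c (a + toℕ u′)))        ≡⟨ strictlyInverseˡ _ ⟩
      c (a + toℕ u′)                    ≡⟨ cong (λ t → c (a + t)) (toℕ-fromℕ< u<2s) ⟩
      c (a + u)                         ∎

  -- a length-2s window is one of K = 2^(2s) values, so two of the K + 1 windows starting in [0, K] coincide
  window-repeats : ∀ c → ∃₂ λ I L′ → I + suc L′ ≤ K × RepeatsAt c I (suc L′)
  window-repeats c with pigeonhole (n<1+n K) (window c ∘ toℕ)
  ... | i , j , i<j , same with m≤n⇒∃[o]m+o≡n i<j
  ...   | L′ , i+1+L′≡j =
    toℕ i , L′ , subst (_≤ K) j≡ (s≤s⁻¹ (toℕ<n j)) ,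
    λ u u<2s → trans (window-injective c (toℕ i) (toℕ j) same u u<2s) (cong (λ a → c (a + u)) j≡)
    where
    j≡ : toℕ j ≡ toℕ i + suc L′
    j≡ = trans (sym i+1+L′≡j) (sym (+-suc (toℕ i) L′))

  segment : (ℕ → Bool) → ℕ → ∀ L → Vec Bool L
  segment c I L = tabulate λ u → c (I + toℕ u)

  cycle-segment : ∀ c I {L′ t} (t<L : t < suc L′) → cycle (segment c I (suc L′)) t ≡ c (I + t)
  cycle-segment c I {t = t} t<L = begin
    cycle (segment c I _) t                    ≡⟨ cycle-< (segment c I _) t<L ⟩
    lookup (segment c I _) (fromℕ< t<L)        ≡⟨ lookup∘tabulate (λ u → c (I + toℕ u)) (fromℕ< t<L) ⟩
    c (I + toℕ (fromℕ< t<L))                   ≡⟨ cong (λ u → c (I + u)) (toℕ-fromℕ< t<L) ⟩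
    c (I + t)                                  ∎
    where open ≡-Reasoning

  repeatsAt⇒cycle-agrees : ∀ {c I L′} → RepeatsAt c I (suc L′) →
                            ∀ t → t < suc L′ + 2 * s → c (I + t) ≡ cycle (segment c I (suc L′)) t
  repeatsAt⇒cycle-agrees {c} {I} {L′} repeats = <-rec _ agree
    where
    L : ℕ
    L = suc L′
    v : Vec Bool L
    v = segment c I L
    agree : ∀ t → (∀ {t′} → t′ < t → t′ < L + 2 * s → c (I + t′) ≡ cycle v t′) →
            t < L + 2 * s → c (I + t) ≡ cycle v t
    agree t rec t< with t <? L
    ... | yes t<L = sym (cycle-segment c I t<L)
    ... | no t≮L with m≤n⇒∃[o]m+o≡n (≮⇒≥ t≮L)
    ...   | u , L+u≡t = begin
      c (I + t)       ≡⟨ cong (λ t → c (I + t)) L+u≡t ⟨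
      c (I + (L + u)) ≡⟨ cong c (+-assoc I L u) ⟨
      c (I + L + u)   ≡⟨ repeats u u<2s ⟨
      c (I + u)       ≡⟨ rec u<t (<-trans u<t t<) ⟩
      cycle v u       ≡⟨ cycle-periodic v u ⟨
      cycle v (u + L) ≡⟨ cong (cycle v) (trans (+-comm u L) L+u≡t) ⟩
      cycle v t       ∎
      where
      open ≡-Reasoning
      u<t : u < t
      u<t = subst (u <_) L+u≡t (m<n+m u z<s)
      u<2s : u < 2 * s
      u<2s = +-cancelˡ-< L u (2 * s) (subst (_< L + 2 * s) (sym L+u≡t) t<)

  repeatsAt⇒dominatingCycle : ∀ {c I L′} → RepeatsAt c I (suc L′) → InteriorDominated c (I + suc L′) →
                               DominatingCycle (segment c I (suc L′))
  repeatsAt⇒dominatingCycle {c} {I} {L′} repeats dom r =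
    dominated-shift c (cycle v) I x (m≤m+n s _) agrees (dom (I + x) (≤-trans (m≤m+n s _) (m≤n+m _ I)) I+x<)
    where
    L : ℕ
    L = suc L′
    v : Vec Bool L
    v = segment c I L
    x : ℕ
    x = s + toℕ r
    I+x< : I + x < I + L + s
    I+x< = begin-strict
      I + (s + toℕ r) ≡⟨ cong (λ t → I + t) (+-comm s (toℕ r)) ⟩
      I + (toℕ r + s) ≡⟨ +-assoc I (toℕ r) s ⟨
      I + toℕ r + s   <⟨ +-monoˡ-< s (+-monoʳ-< I (toℕ<n r)) ⟩
      I + L + s       ∎
      where open ≤-Reasoning
    x+s< : x + s < L + 2 * s
    x+s< = begin-strict
      s + toℕ r + s     ≡⟨ rearrange s (toℕ r) ⟩
      toℕ r + 2 * s     <⟨ +-monoˡ-< (2 * s) (toℕ<n r) ⟩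
      L + 2 * s         ∎
      where
      open ≤-Reasoning
      rearrange : ∀ s r → s + r + s ≡ r + 2 * s
      rearrange = solve-∀
    agrees : ∀ y → x ≤ y + s → y ≤ x + s → c (I + y) ≡ true → cycle v y ≡ true
    agrees y _ y≤x+s cy = trans (sym (repeatsAt⇒cycle-agrees {c} {I} repeats y (≤-<-trans y≤x+s x+s<))) cy

  splice : (ℕ → Bool) → ℕ → ℕ → ℕ → Bool
  splice c I L t with t <? I
  ... | yes _ = c t
  ... | no _ = c (t + L)

  splice-< : ∀ c I L {t} → t < I → splice c I L t ≡ c t
  splice-< c I L {t} t<I with t <? I
  ... | yes _ = refl
  ... | no t≮I = contradiction t<I t≮I

  splice-≥ : ∀ c I L {t} → I ≤ t → splice c I L t ≡ c (t + L)
  splice-≥ c I L {t} I≤t with t <? I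
  ... | yes t<I = contradiction I≤t (<⇒≱ t<I)
  ... | no _ = refl

  splice-interiorDominated : ∀ {c I L} R → RepeatsAt c I L → InteriorDominated c (I + L + R) →
                             InteriorDominated (splice c I L) (I + R)
  splice-interiorDominated {c} {I} {L} R repeats dom x s≤x x< with x <? I + s
  ... | yes x<I+s =
    dominated-shift c (splice c I L) 0 x s≤x agrees (dom x s≤x (<-≤-trans x<I+s (+-monoˡ-≤ s I≤I+L+R)))
    where
    I≤I+L+R : I ≤ I + L + R
    I≤I+L+R = ≤-trans (m≤m+n I L) (m≤m+n (I + L) R)
    agrees : ∀ y → x ≤ y + s → y ≤ x + s → c y ≡ true → splice c I L y ≡ true
    agrees y _ y≤x+s cy with y <? I
    ... | yes _ = cy
    ... | no y≮I with m≤n⇒∃[o]m+o≡n (≮⇒≥ y≮I)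
    ...   | u , I+u≡y = begin
      c (y + L)       ≡⟨ cong (λ y → c (y + L)) I+u≡y ⟨
      c (I + u + L)   ≡⟨ cong c (+-assoc I u L) ⟩
      c (I + (u + L)) ≡⟨ cong (λ t → c (I + t)) (+-comm u L) ⟩
      c (I + (L + u)) ≡⟨ cong c (+-assoc I L u) ⟨
      c (I + L + u)   ≡⟨ repeats u u<2s ⟨
      c (I + u)       ≡⟨ cong c I+u≡y ⟩
      c y             ≡⟨ cy ⟩
      true            ∎
      where
      open ≡-Reasoning
      double : ∀ I s → I + s + s ≡ I + 2 * s
      double = solve-∀
      u<2s : u < 2 * s
      u<2s = +-cancelˡ-< I u (2 * s) (subst₂ _<_ (sym I+u≡y) (double I s) (≤-<-trans y≤x+s (+-monoˡ-< s x<I+s)))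
  ... | no x≮I+s = dominated-shift c (splice c I L) L x s≤x agrees (dom (L + x) (≤-trans s≤x (m≤n+m x L)) L+x<)
    where
    L+x< : L + x < I + L + R + s
    L+x< = begin-strict
      L + x             <⟨ +-monoʳ-< L x< ⟩
      L + (I + R + s)   ≡⟨ rearrange L I R s ⟩
      I + L + R + s     ∎
      where
      open ≤-Reasoning
      rearrange : ∀ L I R s → L + (I + R + s) ≡ I + L + R + s
      rearrange = solve-∀
    agrees : ∀ y → x ≤ y + s → y ≤ x + s → c (L + y) ≡ true → splice c I L y ≡ true
    agrees y x≤y+s _ cy = trans (splice-≥ c I L I≤y) (trans (cong c (+-comm y L)) cy)
      where
      I≤y : I ≤ y
      I≤y = +-cancelʳ-≤ s I y (≤-trans (≮⇒≥ x≮I+s) x≤y+s)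

  count-splice : ∀ c I L R → count (splice c I L) 0 (I + R) ≡ count c 0 I + count c (I + L) R
  count-splice c I L R = trans (count-+ (splice c I L) 0 I R)
    (cong₂ _+_ (count-cong _ c 0 0 I λ t t<I → splice-< c I L t<I)
               (count-cong _ c I (I + L) R λ t _ → trans (splice-≥ c I L (m≤m+n I t)) (cong c (rearrange I t L))))
    where
    rearrange : ∀ I t L → I + t + L ≡ I + L + t
    rearrange = solve-∀

  interiorDominated-mono : ∀ {c m n} → m ≤ n → InteriorDominated c n → InteriorDominated c m
  interiorDominated-mono m≤n dom x s≤x x< = dom x s≤x (<-≤-trans x< (+-monoˡ-≤ s m≤n))

  repeatsAt⇒achievable : ∀ {c I L′} → RepeatsAt c I (suc L′) → InteriorDominated c (I + suc L′) →
                          Achievable (count c I (suc L′)) L′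
  repeatsAt⇒achievable {c} {I} {L′} repeats dom =
    segment c I (suc L′) , repeatsAt⇒dominatingCycle {c} {I} repeats dom ,
    count-cong _ c 0 I (suc L′) λ t t<L → sym (repeatsAt⇒cycle-agrees {c} {I} repeats t (≤-trans t<L (m≤m+n _ _)))

  MinimalRatio : ℕ → ℕ → Set
  MinimalRatio W l = ∀ w′ l′ → suc l′ ≤ K → Achievable w′ l′ → W * suc l′ ≤ w′ * suc l

  private
    cut-bound : ∀ W P I L R a b r E → W * (I + R) ≤ P * (a + r) + E → W * L ≤ P * b →
                W * (I + L + R) ≤ P * (a + b + r) + E
    cut-bound W P I L R a b r E ih cyc = begin
      W * (I + L + R)               ≡⟨ split W I L R ⟩
      W * (I + R) + W * L           ≤⟨ +-mono-≤ ih cyc ⟩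
      P * (a + r) + E + P * b       ≡⟨ merge P a b r E ⟩
      P * (a + b + r) + E           ∎
      where
      open ≤-Reasoning
      split : ∀ W I L R → W * (I + L + R) ≡ W * (I + R) + W * L
      split = solve-∀
      merge : ∀ P a b r E → P * (a + r) + E + P * b ≡ P * (a + b + r) + E
      merge = solve-∀

  -- Cutting out a repeated stretch keeps the rest interior-dominated; the stretch itself is a dominating cycle.
  minimalRatio⇒count-bound : ∀ {W l} → MinimalRatio W l → ∀ n c → InteriorDominated c n →
                              W * n ≤ suc l * count c 0 n + W * K
  minimalRatio⇒count-bound {W} {l} minimal = <-rec _ bound
    where
    bound : ∀ n → (∀ {m} → m < n → ∀ c → InteriorDominated c m → W * m ≤ suc l * count c 0 m + W * K) →
            ∀ c → InteriorDominated c n → W * n ≤ suc l * count c 0 n + W * K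
    bound n rec c dom with n ≤? K
    ... | yes n≤K = ≤-trans (*-monoʳ-≤ W n≤K) (m≤n+m _ _)
    ... | no n≰K with window-repeats c
    ...   | I , L′ , I+L≤K , repeats with m≤n⇒∃[o]m+o≡n (≤-trans I+L≤K (<⇒≤ (≰⇒> n≰K)))
    ...     | R , refl =
      subst (λ k → W * n ≤ suc l * k + W * K) (sym count-decomposition)
        (cut-bound W (suc l) I L R (count c 0 I) (count c I L) (count c (I + L) R) (W * K) ih cyc)
      where
      L : ℕ
      L = suc L′
      I+R<n : I + R < I + L + R
      I+R<n = +-monoˡ-< R (m<m+n I z<s)
      ih : W * (I + R) ≤ suc l * (count c 0 I + count c (I + L) R) + W * K
      ih = subst (λ k → W * (I + R) ≤ suc l * k + W * K) (count-splice c I L R)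
             (rec I+R<n (splice c I L) (splice-interiorDominated R repeats dom))
      cyc : W * L ≤ suc l * count c I L
      cyc = subst (W * L ≤_) (*-comm (count c I L) (suc l))
              (minimal _ L′ (≤-trans (m≤n+m L I) I+L≤K)
                (repeatsAt⇒achievable {c} {I} repeats (interiorDominated-mono (m≤m+n (I + L) R) dom)))
      count-decomposition : count c 0 n ≡ count c 0 I + count c I L + count c (I + L) R
      count-decomposition = trans (count-+ c 0 (I + L) R) (cong (_+ count c (I + L) R) (count-+ c 0 I L))

  private
    lookup-singleton : ∀ (i : Fin 1) → lookup (true ∷ᵥ []ᵥ) i ≡ true
    lookup-singleton Fin.zero = refl

  achievable-1-0 : Achievable 1 0
  achievable-1-0 =
    true ∷ᵥ []ᵥ , (λ r → inj₁ (lookup-singleton ((s + toℕ r) mod 1))) ,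
    cong (λ b → indicator b + 0) (lookup-singleton (0 mod 1))

  achievable⇒≤ : ∀ {w l} → Achievable w l → w ≤ suc l
  achievable⇒≤ {l = l} (v , _ , count≡w) = subst (_≤ suc l) count≡w (count≤ (cycle v) 0 (suc l))

  -- every achievable (w, l) with suc l ≤ K has w ≤ K, so the search space is finite
  minimalRatio-exists : ∃₂ λ W l → suc l ≤ K × Achievable W l × MinimalRatio W l
  minimalRatio-exists = W , l , proj₂ best-ok , proj₁ best-ok , minimal
    where
    ratio : ℕ × ℕ → ℚ
    ratio (w , l) = + w ℚ./ suc l
    Candidate : ℕ × ℕ → Set
    Candidate (w , l) = Achievable w l × suc l ≤ K
    candidate? : ∀ p → Dec (Candidate p)
    candidate? (w , l) = achievable? w l ×-dec (suc l ≤? K)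
    pairs : List (ℕ × ℕ)
    pairs = cartesianProduct (upTo (suc K)) (upTo K)
    candidates : List (ℕ × ℕ)
    candidates = filter candidate? pairs
    best : ℕ × ℕ
    best = argmin ratio (1 , 0) candidates
    W l : ℕ
    W = proj₁ best
    l = proj₂ best
    best-ok : Candidate best
    best-ok = argmin-all ratio {xs = candidates} {P = Candidate} (achievable-1-0 , m^n>0 2 (2 * s))
                (All.tabulate (proj₂ ∘ ∈-filter⁻ candidate? {xs = pairs}))
    minimal : MinimalRatio W l
    minimal w′ l′ l′<K achievable =
      /-≤-/⁻ W l w′ l′ (All.lookup (f[argmin]≤f[xs] {f = ratio} (1 , 0) candidates) w′,l′∈candidates)
      where
      w′<1+K : w′ < suc K
      w′<1+K = s≤s (≤-trans (achievable⇒≤ achievable) l′<K)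
      w′,l′∈candidates : (w′ , l′) ∈ candidates
      w′,l′∈candidates = ∈-filter⁺ candidate? (∈-cartesianProduct⁺ (∈-upTo⁺ w′<1+K) (∈-upTo⁺ l′<K)) (achievable , l′<K)

  private
    difference : ∀ z d → z ℤ.- (z ℤ.+ d) ≡ - d
    difference = ℤ.solve-∀
    difference′ : ∀ z d → z ℤ.- (z ℤ.- d) ≡ d
    difference′ = ℤ.solve-∀

    pos-∸ : ∀ {x d} → d ≤ x → + (x ∸ d) ≡ + x ℤ.- + d
    pos-∸ {x} {d} d≤x = sym (trans (ℤ.m-n≡m⊖n x d) (ℤ.⊖-≥ d≤x))

  periodicExtension-dominating : ∀ {c l} → (∀ x → s ≤ x → Dominated c x) → Dominating S (PeriodicExtension c (suc l))
  periodicExtension-dominating {c} {l} dom z with natural-representative l s z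
  ... | m , x , z+mP≡x , s≤x with dom x s≤x
  ... | inj₁ cx = inj₁ (m , x , z+mP≡x , cx)
  ... | inj₂ (d , d∈S , inj₁ cx+d) = inj₂ (z ℤ.+ + d , (m , x + d , eq , cx+d) , adj)
    where
    swap : ∀ a b c → a ℤ.+ b ℤ.+ c ≡ a ℤ.+ c ℤ.+ b
    swap = ℤ.solve-∀
    eq : z ℤ.+ + d ℤ.+ + (m * suc l) ≡ + (x + d)
    eq = trans (swap z (+ d) _) (trans (cong (ℤ._+ + d) z+mP≡x) (sym (ℤ.pos-+ x d)))
    adj : ∣ z ℤ.- (z ℤ.+ + d) ∣ ∈ S
    adj = subst (_∈ S) (sym (trans (cong ∣_∣ (difference z (+ d))) (ℤ.∣-i∣≡∣i∣ (+ d)))) d∈S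
  ... | inj₂ (d , d∈S , inj₂ cx-d) = inj₂ (z ℤ.- + d , (m , x ∸ d , eq , cx-d) , adj)
    where
    swap : ∀ a b c → a ℤ.- b ℤ.+ c ≡ a ℤ.+ c ℤ.- b
    swap = ℤ.solve-∀
    eq : z ℤ.- + d ℤ.+ + (m * suc l) ≡ + (x ∸ d)
    eq = trans (swap z (+ d) _) (trans (cong (ℤ._- + d) z+mP≡x) (sym (pos-∸ (≤-trans (∈⇒≤s d∈S) s≤x))))
    adj : ∣ z ℤ.- (z ℤ.- + d) ∣ ∈ S
    adj = subst (_∈ S) (sym (cong ∣_∣ (difference′ z (+ d)))) d∈S

  private
    Near : ℤ → ℤ → Set
    Near z y = y ≡ z ⊎ ∃ λ d → d ∈ S × (y ≡ z ℤ.+ + d ⊎ y ≡ z ℤ.- + d)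

    adj⇒near : ∀ z y → Adj S z y → Near z y
    adj⇒near z y adj with z ℤ.- y in eq
    ... | + e = inj₂ (e , adj , inj₂ (trans (sym (difference′ z y)) (cong (λ k → z ℤ.- k) eq)))
    ... | -[1+ e ] = inj₂ (suc e , adj , inj₁ (trans (sym (difference′ z y)) (cong (λ k → z ℤ.- k) eq)))

    near⇒dominated : ∀ {c N x y} → s ≤ x → (∀ t → y ≡ + t ℤ.- + N → c t ≡ true) → Near (+ x ℤ.- + N) y →
                     Dominated c x
    near⇒dominated {c} {N} {x} s≤x marked (inj₁ y≡) = inj₁ (marked x y≡)
    near⇒dominated {c} {N} {x} s≤x marked (inj₂ (d , d∈S , inj₁ y≡)) =
      inj₂ (d , d∈S , inj₁ (marked (x + d)
        (trans y≡ (trans (swap (+ x) (+ N) (+ d)) (cong (ℤ._- + N) (sym (ℤ.pos-+ x d)))))))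
      where
      swap : ∀ a b c → a ℤ.- b ℤ.+ c ≡ a ℤ.+ c ℤ.- b
      swap = ℤ.solve-∀
    near⇒dominated {c} {N} {x} s≤x marked (inj₂ (d , d∈S , inj₂ y≡)) =
      inj₂ (d , d∈S , inj₂ (marked (x ∸ d)
        (trans y≡ (trans (swap (+ x) (+ N) (+ d)) (cong (ℤ._- + N) (sym (pos-∸ d≤x)))))))
      where
      d≤x : d ≤ x
      d≤x = ≤-trans (∈⇒≤s d∈S) s≤x
      swap : ∀ a b c → a ℤ.- b ℤ.- c ≡ a ℤ.- c ℤ.- b
      swap = ℤ.solve-∀

    trim-bound : ∀ W P n t E {a b} → W * (n ∸ t) ≤ P * a + W * E → a ≤ b → W * n ≤ P * b + W * (E + t)
    trim-bound W P n t E {a} {b} trimmed a≤b = begin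
      W * n                         ≤⟨ *-monoʳ-≤ W (m≤n+m∸n n t) ⟩
      W * (t + (n ∸ t))             ≡⟨ *-distribˡ-+ W t (n ∸ t) ⟩
      W * t + W * (n ∸ t)           ≤⟨ +-monoʳ-≤ (W * t) trimmed ⟩
      W * t + (P * a + W * E)       ≤⟨ +-monoʳ-≤ (W * t) (+-monoˡ-≤ (W * E) (*-monoʳ-≤ P a≤b)) ⟩
      W * t + (P * b + W * E)       ≡⟨ rearrange W t (P * b) E ⟩
      P * b + W * (E + t)           ∎
      where
      open ≤-Reasoning
      rearrange : ∀ W t a E → W * t + (a + W * E) ≡ a + W * (E + t)
      rearrange = solve-∀

    interior⇒< : ∀ {x n} → s ≤ x → x < n ∸ 2 * s + s → x < n
    interior⇒< {x} {n} s≤x x< with 2 * s ≤? n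
    ... | yes 2s≤n = <-≤-trans x< (begin
      n ∸ 2 * s + s         ≤⟨ +-monoʳ-≤ (n ∸ 2 * s) (m≤m+n s (s + 0)) ⟩
      n ∸ 2 * s + 2 * s     ≡⟨ m∸n+n≡m 2s≤n ⟩
      n                     ∎)
      where open ≤-Reasoning
    ... | no 2s≰n = contradiction (subst (λ k → x < k + s) (m≤n⇒m∸n≡0 (≰⇒≥ 2s≰n)) x<) (≤⇒≯ s≤x)

  -- D′ need not be decidable, so count instead the t ∈ [0, 2N] for which t - N is the chosen dominator
  -- of some point of [-N, N]: these lie in D′ and dominate the interior of the window.
  dominating⇒lowerRate : ∀ {W l D′} → MinimalRatio W l → Dominating S D′ → LowerRate D′ (suc l) W (W * (K + 2 * s))
  dominating⇒lowerRate {W} {l} {D′} minimal dominating N =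
    count c 0 n , count⇒atLeast {D′} N c c⇒D′ ,
    trim-bound W (suc l) n (2 * s) K (minimalRatio⇒count-bound {W} minimal _ c dominated)
      (count-mono c 0 (m∸n≤m n (2 * s)))
    where
    n : ℕ
    n = suc (2 * N)
    pick : ∀ z → Σ ℤ λ y → D′ y × Near z y
    pick z with dominating z
    ... | inj₁ D′z = z , D′z , inj₁ refl
    ... | inj₂ (y , D′y , adj) = y , D′y , adj⇒near z y adj
    dominator : ℤ → ℤ
    dominator z = proj₁ (pick z)
    marked? : ∀ t → Dec (∃ λ (u : Fin n) → dominator (+ toℕ u ℤ.- + N) ≡ + t ℤ.- + N)
    marked? t = any? λ u → dominator (+ toℕ u ℤ.- + N) ℤ.≟ + t ℤ.- + N
    c : ℕ → Bool
    c t = isYes (marked? t)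
    c⇒D′ : ∀ t → c t ≡ true → D′ (+ t ℤ.- + N)
    c⇒D′ t ct = let u , eq = toWitness (Equivalence.from T-≡ ct) in subst D′ eq (proj₁ (proj₂ (pick _)))
    marked : ∀ {x} → x < n → ∀ y → dominator (+ x ℤ.- + N) ≡ + y ℤ.- + N → c y ≡ true
    marked {x} x<n y eq = trans (isYes≗does (marked? y)) (dec-true (marked? y)
      (fromℕ< x<n , subst (λ t → dominator (+ t ℤ.- + N) ≡ + y ℤ.- + N) (sym (toℕ-fromℕ< x<n)) eq))
    dominated : InteriorDominated c (n ∸ 2 * s)
    dominated x s≤x x< =
      near⇒dominated {c} {N} s≤x (marked (interior⇒< s≤x x<)) (proj₂ (proj₂ (pick (+ x ℤ.- + N))))

  periodicExtension-optimal : ∀ {W l} (v : Vec Bool (suc l)) → DominatingCycle v → count (cycle v) 0 (suc l) ≡ W →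
    MinimalRatio W l → Dominating S (PeriodicExtension (cycle v) (suc l)) ×
    (∀ D′ → Dominating S D′ → DensityLe (PeriodicExtension (cycle v) (suc l)) D′)
  periodicExtension-optimal {W} {l} v dominatingCycle count≡W minimal =
    periodicExtension-dominating {cycle v} {l} (dominatingCycle⇒dominated {v = v} dominatingCycle) ,
    λ D′ dominating → rates⇒densityLe {D} {D′} {l} {W} {suc l * W} {W * (K + 2 * s)}
                        upper (dominating⇒lowerRate {W} {l} {D′} minimal dominating)
    where
    D : Subset
    D = PeriodicExtension (cycle v) (suc l)
    upper : UpperRate D (suc l) W (suc l * W)
    upper = subst (λ w → UpperRate D (suc l) w (suc l * w)) count≡W
              (periodicExtension-upperRate {cycle v} {l} (cycle-periodic v))

maxList-positive : ∀ {S} → S ≢ [] → All (0 <_) S → 0 < maxList S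
maxList-positive {[]} S≢[] _ = contradiction refl S≢[]
maxList-positive {d ∷ _} _ (0<d ∷ _) = <-≤-trans 0<d (m≤m⊔n d _)

theorem4 : (S : List ℕ) → S ≢ [] → All (0 <_) S →
    Σ Subset λ D → Dominating S D ×
      (∃ λ p → 1 ≤ p × p ≤ (2 * maxList S) * 2 ^ (2 * maxList S) × Periodic D p) ×
      (∀ (D' : Subset) → Dominating S D' → DensityLe D D')
theorem4 S S≢[] S-pos =
  let W , l , P≤K , (v , dominatingCycle , count≡W) , minimal = minimalRatio-exists
      dominating , optimal = periodicExtension-optimal v dominatingCycle count≡W minimal
  in PeriodicExtension (cycle v) (suc l) , dominating ,
     (suc l , s≤s z≤n , period-bound P≤K , periodicExtension-periodic (cycle-periodic v)) , optimal
  where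
  open Domination S
  period-bound : ∀ {P} → P ≤ K → P ≤ 2 * s * K
  period-bound P≤K = ≤-trans P≤K (subst (_≤ 2 * s * K) (*-identityˡ K) (*-monoˡ-≤ K 1≤2s))
    where
    1≤2s : 1 ≤ 2 * s
    1≤2s = ≤-trans (maxList-positive S≢[] S-pos) (m≤m+n s _)
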